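{- Let $x=P(x)$ be a max-minPPS in simple normal form and let $\tau$ be a policy for the min player. Then $\tau$ is LDF if and only if the maxPPS $x=P_{*,\tau}(x)$ contains no closed set.
   Context: A max-minPPS in SNF is a system $x_i=P_i(x)$ where each $P_i$ is of form L ($a_{i,0}+\sum_ja_{i,j}x_j$, rational $a_{i,j}\ge0$ summing to at most 1), form Q ($x_jx_k$), or form M ($\max\{x_j,x_k\}$ or $\min\{x_j,x_k\}$). A policy for the min (max) player assigns a probability distribution over the two choices at each min (max) variable; $P_{*,\tau}$ is the maxPPS obtained by replacing each min by the convex combination given by $\tau$, and $P_{\sigma,\tau}$ the PPS obtained by fixing both $\sigma$ and $\tau$. Dependency graph: edge $x_i\to x_j$ iff $x_j$ appears in $P_i$. A PPS $x=Q(x)$ is LDF if every variable either is, or depends via a directed path on, a variable $x_l$ with $Q_l$ having a term of degree $\ge2$, or $Q_l(\mathbf{0})>0$, or $Q_l(\mathbf{1})<1$. A min policy $\tau$ is LDF if $x=P_{\sigma,\tau}(x)$ is LDF for every max policy $\sigma$. A closed set of a maxPPS is a set $S$ of variables such that (i) the dependency subgraph induced by $S$ contains at least one edge and is strongly connected; (ii) $S$ contains only variables whose right-hand sides are of max type (form M) or linear type (form L); (iii) for every linear-type variable $x_i\in S$, $P_i$ contains only variables of $S$, $P_i(\mathbf{0})=0$ and $P_i(\mathbf{1})=1$. -}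

module Defs where

open import Data.Nat using (ℕ; zero; suc)
open import Data.Fin using (Fin; zero; suc; _≟_)
open import Data.Fin.Subset using (Subset; _∈_)
open import Data.Rational using (ℚ; 0ℚ; 1ℚ; _+_; _-_; _*_; _≤_; _<_)
open import Data.Product using (Σ; ∃; _×_; _,_)
open import Data.Sum using (_⊎_)
open import Data.Unit using (⊤)
open import Data.Empty using (⊥)
open import Data.Bool using (if_then_else_)
open import Relation.Nullary using (¬_; does)
open import Relation.Binary.PropositionalEquality using (_≡_)
open import Relation.Binary.Construct.Closure.ReflexiveTransitive using (Star)

sumℚ : ∀ {n} → (Fin n → ℚ) → ℚ
sumℚ {zero}  f = 0ℚ
sumℚ {suc n} f = f zero + sumℚ (λ i → f (suc i))

data RHS (n : ℕ) : Set where
  L   : ℚ → (Fin n → ℚ) → RHS n   -- a₀ + Σ_j a_j x_j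
  Q   : Fin n → Fin n → RHS n     -- x_j x_k
  Max : Fin n → Fin n → RHS n
  Min : Fin n → Fin n → RHS n

System : ℕ → Set
System n = Fin n → RHS n

WFRHS : ∀ {n} → RHS n → Set
WFRHS (L a₀ a)  = (0ℚ ≤ a₀) × (∀ j → 0ℚ ≤ a j) × (a₀ + sumℚ a ≤ 1ℚ)
WFRHS (Q _ _)   = ⊤
WFRHS (Max _ _) = ⊤
WFRHS (Min _ _) = ⊤

MaxMinPPS-SNF : ∀ {n} → System n → Set
MaxMinPPS-SNF P = ∀ i → WFRHS (P i)

-- A (randomised) policy: at each variable i, the probability τ i ∈ [0,1]
-- of choosing the first argument x_j (and 1 - τ i of choosing x_k).
-- Values at variables of the wrong type are irrelevant.
Policy : ℕ → Set
Policy n = Fin n → ℚ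

IsPolicy : ∀ {n} → Policy n → Set
IsPolicy τ = ∀ i → (0ℚ ≤ τ i) × (τ i ≤ 1ℚ)

convex : ∀ {n} → ℚ → Fin n → Fin n → RHS n
convex p j k = L 0ℚ (λ l → (if does (l ≟ j) then p else 0ℚ)
                         + (if does (l ≟ k) then 1ℚ - p else 0ℚ))

replaceMin : ∀ {n} → ℚ → RHS n → RHS n
replaceMin p (Min j k) = convex p j k
replaceMin p r         = r

replaceMax : ∀ {n} → ℚ → RHS n → RHS n
replaceMax p (Max j k) = convex p j k
replaceMax p r         = r

fixMin : ∀ {n} → Policy n → System n → System n
fixMin τ P i = replaceMin (τ i) (P i)

fixMax : ∀ {n} → Policy n → System n → System n
fixMax σ P i = replaceMax (σ i) (P i)

fixBoth : ∀ {n} → Policy n → Policy n → System n → System n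
fixBoth σ τ P = fixMax σ (fixMin τ P)

Appears : ∀ {n} → RHS n → Fin n → Set
Appears (L a₀ a)  l = ¬ (a l ≡ 0ℚ)
Appears (Q j k)   l = (l ≡ j) ⊎ (l ≡ k)
Appears (Max j k) l = (l ≡ j) ⊎ (l ≡ k)
Appears (Min j k) l = (l ≡ j) ⊎ (l ≡ k)

Edge : ∀ {n} → System n → Fin n → Fin n → Set
Edge P i j = Appears (P i) j

at0 : ∀ {n} → RHS n → ℚ
at0 (L a₀ a)  = a₀
at0 (Q _ _)   = 0ℚ
at0 (Max _ _) = 0ℚ
at0 (Min _ _) = 0ℚ

at1 : ∀ {n} → RHS n → ℚ
at1 (L a₀ a)  = a₀ + sumℚ a
at1 (Q _ _)   = 1ℚ
at1 (Max _ _) = 1ℚ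
at1 (Min _ _) = 1ℚ

HasDeg2 : ∀ {n} → RHS n → Set
HasDeg2 (Q _ _) = ⊤
HasDeg2 _       = ⊥

Leaky : ∀ {n} → RHS n → Set
Leaky r = HasDeg2 r ⊎ (0ℚ < at0 r) ⊎ (at1 r < 1ℚ)

LDF : ∀ {n} → System n → Set
LDF P = ∀ i → ∃ λ l → Star (Edge P) i l × Leaky (P l)

LDFMinPolicy : ∀ {n} → System n → Policy n → Set
LDFMinPolicy P τ = ∀ σ → IsPolicy σ → LDF (fixBoth σ τ P)

IsMaxOrLinear : ∀ {n} → RHS n → Set
IsMaxOrLinear (L _ _)   = ⊤
IsMaxOrLinear (Max _ _) = ⊤
IsMaxOrLinear _         = ⊥

LinearClosed : ∀ {n} → Subset n → RHS n → Set
LinearClosed S (L a₀ a) = (∀ j → Appears (L a₀ a) j → j ∈ S)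
                        × (a₀ ≡ 0ℚ) × (a₀ + sumℚ a ≡ 1ℚ)
LinearClosed S _        = ⊤

InducedEdge : ∀ {n} → System n → Subset n → Fin n → Fin n → Set
InducedEdge P S i j = (i ∈ S) × (j ∈ S) × Edge P i j

ClosedSet : ∀ {n} → System n → Subset n → Set
ClosedSet P S =
    (∃ λ i → ∃ λ j → InducedEdge P S i j)
  × (∀ i j → i ∈ S → j ∈ S → Star (InducedEdge P S) i j)
  × (∀ i → i ∈ S → IsMaxOrLinear (P i))
  × (∀ i → i ∈ S → LinearClosed S (P i))

-- Fix a max policy σ. If no leaky variable is reachable from x_i in the
-- graph of P_{σ,τ}, a bottom strongly connected component reachable from x_i
-- consists of non-leaky variables only; these are max or linear variables
-- (quadratic ones are leaky) whose linear forms have constant 0 and total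
-- weight 1, and the component is closed in P_{*,τ}, because edges of P_{σ,τ}
-- are edges of P_{*,τ}. Conversely, from a closed set S of P_{*,τ} let σ send
-- every max variable of S to a successor in S: then no path of P_{σ,τ}
-- leaves S and no variable of S is leaky, so τ is not LDF.
module Submission where

open import Defs
open import Data.Nat using (ℕ; zero; suc)
open import Data.Fin using (Fin; zero; suc; _≟_)
open import Data.Fin.Properties using (any?)
open import Data.Fin.Subset using (Subset; _∈_; _∪_; ⁅_⁆; _⊂_; _⊃_; _⊆_)
open import Data.Fin.Subset.Properties using (_∈?_; x∈⁅x⁆; x∈⁅y⁆⇒x≡y; p⊆p∪q; q⊆p∪q; x∈p∪q⁻)
open import Data.Fin.Subset.Induction using (⊂-wellFounded; ⊃-wellFounded)
open import Data.Rational using (ℚ; 0ℚ; 1ℚ; _+_; _-_; _≤_; _<_)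
import Data.Rational.Properties as ℚ
open import Algebra.Bundles using (CommutativeMonoid)
open import Algebra.Properties.AbelianGroup ℚ.+-0-abelianGroup using (xyx⁻¹≈y)
open import Algebra.Properties.CommutativeSemigroup
  (CommutativeMonoid.commutativeSemigroup ℚ.+-0-commutativeMonoid) using (interchange)
open import Data.Bool using (if_then_else_)
open import Data.Unit using (tt)
open import Data.Empty using (⊥-elim)
open import Data.Product using (∃; _×_; _,_)
open import Data.Sum using (_⊎_; inj₁; inj₂; [_,_])
open import Function.Base using (id)
open import Function.Bundles using (_⇔_; mk⇔)
open import Induction.WellFounded using (Acc; acc)
open import Level using (Level)
open import Relation.Binary.Core using (Rel)
open import Relation.Binary.Definitions using (Decidable)
open import Relation.Binary.PropositionalEquality using (_≡_; refl; sym; trans; cong; cong₂; module ≡-Reasoning)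
open import Relation.Binary.Construct.Closure.ReflexiveTransitive using (Star; ε; _◅_; _◅◅_)
open import Relation.Nullary using (¬_; Dec; yes; no; does)
open import Relation.Nullary.Decidable using (_×-dec_; _⊎-dec_; ¬?; decidable-stable)

sumℚ-zero : ∀ {n} {f : Fin n → ℚ} → (∀ l → f l ≡ 0ℚ) → sumℚ f ≡ 0ℚ
sumℚ-zero {zero}  f≡0 = refl
sumℚ-zero {suc n} f≡0 = cong₂ _+_ (f≡0 zero) (sumℚ-zero (λ l → f≡0 (suc l)))

sumℚ-+ : ∀ {n} (f g : Fin n → ℚ) → sumℚ (λ l → f l + g l) ≡ sumℚ f + sumℚ g
sumℚ-+ {zero}  f g = refl
sumℚ-+ {suc n} f g =
  trans (cong (f zero + g zero +_) (sumℚ-+ (λ l → f (suc l)) (λ l → g (suc l))))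
        (interchange (f zero) (g zero) _ _)

sumℚ-indicator : ∀ {n} (j : Fin n) (p : ℚ) →
                 sumℚ (λ l → if does (l ≟ j) then p else 0ℚ) ≡ p
sumℚ-indicator {suc n} zero    p =
  trans (cong (p +_) (sumℚ-zero {n} (λ _ → refl))) (ℚ.+-identityʳ p)
sumℚ-indicator {suc n} (suc j) p = trans (ℚ.+-identityˡ _) (sumℚ-indicator j p)

at1-convex : ∀ {n} p (j k : Fin n) → at1 (convex p j k) ≡ 1ℚ
at1-convex p j k = begin
  0ℚ + sumℚ (λ l → indicator j p l + indicator k (1ℚ - p) l)
    ≡⟨ ℚ.+-identityˡ _ ⟩
  sumℚ (λ l → indicator j p l + indicator k (1ℚ - p) l)
    ≡⟨ sumℚ-+ (indicator j p) (indicator k (1ℚ - p)) ⟩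
  sumℚ (indicator j p) + sumℚ (indicator k (1ℚ - p))
    ≡⟨ cong₂ _+_ (sumℚ-indicator j p) (sumℚ-indicator k (1ℚ - p)) ⟩
  p + (1ℚ - p)
    ≡⟨ sym (ℚ.+-assoc p 1ℚ _) ⟩
  p + 1ℚ - p
    ≡⟨ xyx⁻¹≈y p 1ℚ ⟩
  1ℚ ∎
  where
  open ≡-Reasoning
  indicator : _ → ℚ → _ → ℚ
  indicator i q l = if does (l ≟ i) then q else 0ℚ

appears-convex : ∀ {n} p {j k w : Fin n} → Appears (convex p j k) w → w ≡ j ⊎ w ≡ k
appears-convex p {j} {k} {w} w∈ with w ≟ j | w ≟ k
... | yes w≡j | _       = inj₁ w≡j
... | no _    | yes w≡k = inj₂ w≡k
... | no _    | no _    = ⊥-elim (w∈ refl)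

appears-convex-1 : ∀ {n} {j k w : Fin n} → Appears (convex 1ℚ j k) w → w ≡ j
appears-convex-1 {j = j} {k} {w} w∈ with w ≟ j | w ≟ k
... | yes w≡j | _     = w≡j
... | no _    | yes _ = ⊥-elim (w∈ refl)
... | no _    | no _  = ⊥-elim (w∈ refl)

appears-convex-0 : ∀ {n} {j k w : Fin n} → Appears (convex 0ℚ j k) w → w ≡ k
appears-convex-0 {j = j} {k} {w} w∈ with w ≟ k | w ≟ j
... | yes w≡k | _     = w≡k
... | no _    | yes _ = ⊥-elim (w∈ refl)
... | no _    | no _  = ⊥-elim (w∈ refl)

ForwardClosed : ∀ {n ℓ} → Rel (Fin n) ℓ → Subset n → Set ℓ
ForwardClosed R S = ∀ {v w} → v ∈ S → R v w → w ∈ S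

Star-closed : ∀ {n ℓ} {R : Rel (Fin n) ℓ} {S : Subset n} → ForwardClosed R S →
              ∀ {a b} → a ∈ S → Star R a b → b ∈ S
Star-closed closed a∈S ε          = a∈S
Star-closed closed a∈S (aRc ◅ cb) = Star-closed closed (closed a∈S aRc) cb

Star-induced : ∀ {n ℓ ℓ′} {R : Rel (Fin n) ℓ} {R′ : Rel (Fin n) ℓ′} {S : Subset n} →
               (∀ {a b} → R a b → R′ a b) → ForwardClosed R S →
               ∀ {a b} → a ∈ S → Star R a b → Star (λ x y → x ∈ S × y ∈ S × R′ x y) a b
Star-induced R⊆R′ closed a∈S ε          = ε
Star-induced R⊆R′ closed a∈S (aRc ◅ cb) =
  (a∈S , closed a∈S aRc , R⊆R′ aRc) ◅ Star-induced R⊆R′ closed (closed a∈S aRc) cb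

module _ {n : ℕ} {ℓ : Level} {R : Rel (Fin n) ℓ} (R? : Decidable R) where

  record ReachableSet (i : Fin n) : Set ℓ where
    field
      members   : Subset n
      root      : i ∈ members
      reachable : ∀ {v} → v ∈ members → Star R i v
      closed    : ForwardClosed R members

  reachableSet : ∀ i → ReachableSet i
  reachableSet i = grow ⁅ i ⁆ (⊃-wellFounded _) (x∈⁅x⁆ i) reach-⁅i⁆
    where
    reach-⁅i⁆ : ∀ {v} → v ∈ ⁅ i ⁆ → Star R i v
    reach-⁅i⁆ v∈ with refl ← x∈⁅y⁆⇒x≡y i v∈ = ε

    grow : (V : Subset n) → Acc _⊃_ V → i ∈ V → (∀ {v} → v ∈ V → Star R i v) →
           ReachableSet i
    grow V (acc larger) i∈V reach
      with any? (λ v → any? (λ w → v ∈? V ×-dec ¬? (w ∈? V) ×-dec R? v w))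
    ... | yes (v , w , v∈V , w∉V , vRw) =
      grow (V ∪ ⁅ w ⁆) (larger (p⊆p∪q ⁅ w ⁆ , w , q⊆p∪q V ⁅ w ⁆ (x∈⁅x⁆ w) , w∉V))
           (p⊆p∪q ⁅ w ⁆ i∈V) reach′
      where
      reach′ : ∀ {u} → u ∈ V ∪ ⁅ w ⁆ → Star R i u
      reach′ u∈ with x∈p∪q⁻ V ⁅ w ⁆ u∈
      ... | inj₁ u∈V = reach u∈V
      ... | inj₂ u∈w with refl ← x∈⁅y⁆⇒x≡y w u∈w = reach v∈V ◅◅ (vRw ◅ ε)
    ... | no no-exit = record
      { members   = V
      ; root      = i∈V
      ; reachable = reach
      ; closed    = λ {v} {w} v∈V vRw →
          decidable-stable (w ∈? V) (λ w∉V → no-exit (v , w , v∈V , w∉V , vRw))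
      }

  module Reach = ReachableSet

  reach : Fin n → Subset n
  reach i = Reach.members (reachableSet i)

  reach-⊆ : ∀ {i j} → j ∈ reach i → reach j ⊆ reach i
  reach-⊆ {i} j∈ k∈ =
    Star-closed (Reach.closed (reachableSet i)) (Reach.root (reachableSet i))
                (Reach.reachable (reachableSet i) j∈ ◅◅ Reach.reachable (reachableSet _) k∈)

  record BottomComponent (i : Fin n) : Set ℓ where
    field
      members   : Subset n
      element   : Fin n
      element∈  : element ∈ members
      reachable : ∀ {v} → v ∈ members → Star R i v
      closed    : ForwardClosed R members
      connected : ∀ {a b} → a ∈ members → b ∈ members → Star R a b

  extend : ∀ {i j} → Star R i j → BottomComponent j → BottomComponent i
  extend i⇝j B = record
    { members   = members
    ; element   = element
    ; element∈  = element∈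
    ; reachable = λ v∈ → i⇝j ◅◅ reachable v∈
    ; closed    = closed
    ; connected = connected
    }
    where open BottomComponent B

  -- Pass to a reachable vertex that cannot reach back: its reachable set is strictly smaller.
  bottomComponent : ∀ i → BottomComponent i
  bottomComponent i = descend i (⊂-wellFounded _)
    where
    descend : ∀ i → Acc _⊂_ (reach i) → BottomComponent i
    descend i (acc smaller) with any? (λ j → j ∈? reach i ×-dec ¬? (i ∈? reach j))
    ... | yes (j , j∈ , i∉) =
      extend (Reach.reachable (reachableSet i) j∈)
             (descend j (smaller (reach-⊆ j∈ , i , Reach.root (reachableSet i) , i∉)))
    ... | no no-escape = record
      { members   = reach i
      ; element   = i
      ; element∈  = Reach.root (reachableSet i)
      ; reachable = Reach.reachable (reachableSet i)
      ; closed    = Reach.closed (reachableSet i)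
      ; connected = λ {a} a∈ b∈ →
          Reach.reachable (reachableSet a)
                    (decidable-stable (i ∈? reach a) (λ i∉ → no-escape (a , a∈ , i∉)))
          ◅◅ Reach.reachable (reachableSet i) b∈
      }

appears? : ∀ {n} (r : RHS n) → ∀ l → Dec (Appears r l)
appears? (L a₀ a)  l = ¬? (a l ℚ.≟ 0ℚ)
appears? (Q j k)   l = l ≟ j ⊎-dec l ≟ k
appears? (Max j k) l = l ≟ j ⊎-dec l ≟ k
appears? (Min j k) l = l ≟ j ⊎-dec l ≟ k

hasDeg2? : ∀ {n} (r : RHS n) → Dec (HasDeg2 r)
hasDeg2? (L _ _)   = no λ ()
hasDeg2? (Q _ _)   = yes tt
hasDeg2? (Max _ _) = no λ ()
hasDeg2? (Min _ _) = no λ ()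

leaky? : ∀ {n} (r : RHS n) → Dec (Leaky r)
leaky? r = hasDeg2? r ⊎-dec (0ℚ ℚ.<? at0 r ⊎-dec at1 r ℚ.<? 1ℚ)

¬Leaky-L : ∀ {n a₀} {a : Fin n → ℚ} → a₀ ≡ 0ℚ → a₀ + sumℚ a ≡ 1ℚ → ¬ Leaky (L a₀ a)
¬Leaky-L a₀≡0 at1≡1 (inj₁ ())
¬Leaky-L a₀≡0 at1≡1 (inj₂ (inj₁ 0<a₀)) = ℚ.<-irrefl (sym a₀≡0) 0<a₀
¬Leaky-L a₀≡0 at1≡1 (inj₂ (inj₂ at1<1)) = ℚ.<-irrefl at1≡1 at1<1

¬Leaky-convex : ∀ {n} p (j k : Fin n) → ¬ Leaky (convex p j k)
¬Leaky-convex {n} p j k = ¬Leaky-L {n} refl (at1-convex p j k)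

¬Leaky⇒at0≡0 : ∀ {n} {r : RHS n} → 0ℚ ≤ at0 r → ¬ Leaky r → at0 r ≡ 0ℚ
¬Leaky⇒at0≡0 0≤at0 ¬leaky = ℚ.≤-antisym (ℚ.≮⇒≥ (λ 0<at0 → ¬leaky (inj₂ (inj₁ 0<at0)))) 0≤at0

¬Leaky⇒at1≡1 : ∀ {n} {r : RHS n} → at1 r ≤ 1ℚ → ¬ Leaky r → at1 r ≡ 1ℚ
¬Leaky⇒at1≡1 at1≤1 ¬leaky = ℚ.≤-antisym at1≤1 (ℚ.≮⇒≥ (λ at1<1 → ¬leaky (inj₂ (inj₂ at1<1))))

¬Leaky⇒appears : ∀ {n} (r : RHS n) → ¬ Leaky r → ∃ (Appears r)
¬Leaky⇒appears (L a₀ a) ¬leaky with any? (appears? (L a₀ a))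
... | yes appearing = appearing
... | no  none      = ⊥-elim (¬leaky (inj₂ (inj₂ at1<1)))
  where
  open ℚ.≤-Reasoning
  a≡0 : ∀ l → a l ≡ 0ℚ
  a≡0 l = decidable-stable (a l ℚ.≟ 0ℚ) (λ a≢0 → none (l , a≢0))
  at1<1 : a₀ + sumℚ a < 1ℚ
  at1<1 = begin-strict
    a₀ + sumℚ a ≡⟨ cong (a₀ +_) (sumℚ-zero a≡0) ⟩
    a₀ + 0ℚ     ≡⟨ ℚ.+-identityʳ a₀ ⟩
    a₀          ≤⟨ ℚ.≮⇒≥ (λ 0<a₀ → ¬leaky (inj₂ (inj₁ 0<a₀))) ⟩
    0ℚ          <⟨ ℚ.positive⁻¹ 1ℚ ⟩
    1ℚ          ∎
¬Leaky⇒appears (Q j k)   ¬leaky = ⊥-elim (¬leaky (inj₁ tt))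
¬Leaky⇒appears (Max j k) ¬leaky = j , inj₁ refl
¬Leaky⇒appears (Min j k) ¬leaky = j , inj₁ refl

replaceMin-bounds : ∀ {n} p (r : RHS n) → WFRHS r →
                    0ℚ ≤ at0 (replaceMin p r) × at1 (replaceMin p r) ≤ 1ℚ
replaceMin-bounds p (L a₀ a)  (0≤a₀ , _ , at1≤1) = 0≤a₀ , at1≤1
replaceMin-bounds p (Q _ _)   _ = ℚ.≤-refl , ℚ.≤-refl
replaceMin-bounds p (Max _ _) _ = ℚ.≤-refl , ℚ.≤-refl
replaceMin-bounds p (Min j k) _ = ℚ.≤-refl , ℚ.≤-reflexive (at1-convex p j k)

appears-replaceMax : ∀ {n} p (r : RHS n) {w} → Appears (replaceMax p r) w → Appears r w
appears-replaceMax p (L _ _)   w∈ = w∈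
appears-replaceMax p (Q _ _)   w∈ = w∈
appears-replaceMax p (Max j k) w∈ = appears-convex p {j} {k} w∈
appears-replaceMax p (Min _ _) w∈ = w∈

isMaxOrLinear-replaceMin : ∀ {n} p q (r : RHS n) →
  ¬ Leaky (replaceMax q (replaceMin p r)) → IsMaxOrLinear (replaceMin p r)
isMaxOrLinear-replaceMin p q (L _ _)   _      = tt
isMaxOrLinear-replaceMin p q (Q _ _)   ¬leaky = ¬leaky (inj₁ tt)
isMaxOrLinear-replaceMin p q (Max _ _) _      = tt
isMaxOrLinear-replaceMin p q (Min _ _) _      = tt

linearClosed : ∀ {n} {S : Subset n} p (r : RHS n) → 0ℚ ≤ at0 r → at1 r ≤ 1ℚ →
  ¬ Leaky (replaceMax p r) → (∀ w → Appears (replaceMax p r) w → w ∈ S) → LinearClosed S r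
linearClosed p (L a₀ a)  0≤at0 at1≤1 ¬leaky inS =
  inS , ¬Leaky⇒at0≡0 {r = L a₀ a} 0≤at0 ¬leaky , ¬Leaky⇒at1≡1 {r = L a₀ a} at1≤1 ¬leaky
linearClosed p (Q _ _)   _ _ _ _ = tt
linearClosed p (Max _ _) _ _ _ _ = tt
linearClosed p (Min _ _) _ _ _ _ = tt

pointInto : ∀ {n} → Subset n → RHS n → ℚ
pointInto S (Max j k) = if does (j ∈? S) then 1ℚ else 0ℚ
pointInto S _         = 0ℚ

pointInto-isPolicy : ∀ {n} (S : Subset n) (P : System n) → IsPolicy (λ l → pointInto S (P l))
pointInto-isPolicy S P l with P l
... | L _ _   = ℚ.≤-refl , ℚ.nonNegative⁻¹ 1ℚ
... | Q _ _   = ℚ.≤-refl , ℚ.nonNegative⁻¹ 1ℚ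
... | Min _ _ = ℚ.≤-refl , ℚ.nonNegative⁻¹ 1ℚ
... | Max j _ with j ∈? S
...   | yes _ = ℚ.nonNegative⁻¹ 1ℚ , ℚ.≤-refl
...   | no _  = ℚ.≤-refl , ℚ.nonNegative⁻¹ 1ℚ

pointInto-stays : ∀ {n} {S : Subset n} (r : RHS n) → IsMaxOrLinear r → LinearClosed S r →
  ∀ {w} → w ∈ S → Appears r w → ∀ v → Appears (replaceMax (pointInto S r) r) v → v ∈ S
pointInto-stays (L _ _) _ (inS , _) _ _ = inS
pointInto-stays {S = S} (Max j k) _ _ w∈S w∈ v v∈ with j ∈? S
... | yes j∈S with refl ← appears-convex-1 {j = j} {k} {v} v∈ = j∈S
... | no  j∉S with refl ← appears-convex-0 {j = j} {k} {v} v∈ with w∈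
...   | inj₁ refl = ⊥-elim (j∉S w∈S)
...   | inj₂ refl = w∈S

¬Leaky-replaceMax : ∀ {n} {S : Subset n} p (r : RHS n) → IsMaxOrLinear r → LinearClosed S r →
                    ¬ Leaky (replaceMax p r)
¬Leaky-replaceMax p (L _ a)   _ (_ , a₀≡0 , at1≡1) = ¬Leaky-L {a = a} a₀≡0 at1≡1
¬Leaky-replaceMax p (Max j k) _ _                  = ¬Leaky-convex p j k

closedSet-successor : ∀ {n} {P : System n} {S : Subset n} → ClosedSet P S →
                      ∀ {s} → s ∈ S → ∃ λ w → w ∈ S × Appears (P s) w
closedSet-successor ((i , j , i∈S , j∈S , i→j) , connected , _) {s} s∈S
  with connected s i s∈S i∈S
... | ε                   = j , j∈S , i→j
... | (_ , w∈S , s→w) ◅ _ = _ , w∈S , s→w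

closedSet⇒¬LDF : ∀ {n} {P : System n} {S : Subset n} → ClosedSet P S →
                 ¬ LDF (fixMax (λ l → pointInto S (P l)) P)
closedSet⇒¬LDF {P = P} {S} closed@((i , _ , i∈S , _) , _ , maxOrLinear , linear) ldf
  with ldf i
... | l , i⇝l , leaky = ¬Leaky-replaceMax _ (P l) (maxOrLinear l l∈S) (linear l l∈S) leaky
  where
  stays : ForwardClosed (Edge (fixMax (λ l → pointInto S (P l)) P)) S
  stays {s} s∈S s→w with w , w∈S , s→w′ ← closedSet-successor closed s∈S =
    pointInto-stays (P s) (maxOrLinear s s∈S) (linear s s∈S) w∈S s→w′ _ s→w
  l∈S : l ∈ S
  l∈S = Star-closed stays i∈S i⇝l

module _ {n} (P : System n) (wf : MaxMinPPS-SNF P) (τ σ : Policy n) where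

  private
    Pστ : System n
    Pστ = fixBoth σ τ P

  nonLeakyComponent⇒closedSet : ∀ {S s} → s ∈ S →
    ForwardClosed (Edge Pστ) S → (∀ {a b} → a ∈ S → b ∈ S → Star (Edge Pστ) a b) →
    (∀ {s} → s ∈ S → ¬ Leaky (Pστ s)) → ClosedSet (fixMin τ P) S
  nonLeakyComponent⇒closedSet {S} {s} s∈S closed connected ¬leaky =
    let w , s→w = ¬Leaky⇒appears (Pστ s) (¬leaky s∈S) in
    (s , w , s∈S , closed s∈S s→w , appears-replaceMax (σ s) (fixMin τ P s) s→w)
    , (λ a b a∈S b∈S → Star-induced (λ {x} → appears-replaceMax (σ x) (fixMin τ P x))
                                     closed a∈S (connected a∈S b∈S))
    , (λ a a∈S → isMaxOrLinear-replaceMin (τ a) (σ a) (P a) (¬leaky a∈S))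
    , (λ a a∈S → let 0≤at0 , at1≤1 = replaceMin-bounds (τ a) (P a) (wf a) in
         linearClosed (σ a) (fixMin τ P a) 0≤at0 at1≤1 (¬leaky a∈S) (λ _ → closed a∈S))

  module _ (i : Fin n) where
    open BottomComponent (bottomComponent (λ a → appears? (Pστ a)) i)

    leakOrClosedSet : (∃ λ l → Star (Edge Pστ) i l × Leaky (Pστ l)) ⊎ ∃ (ClosedSet (fixMin τ P))
    leakOrClosedSet with any? (λ s → s ∈? members ×-dec leaky? (Pστ s))
    ... | yes (s , s∈ , leaky) = inj₁ (s , reachable s∈ , leaky)
    ... | no none = inj₂ (members , nonLeakyComponent⇒closedSet element∈ closed connected
                                     (λ s∈ leaky → none (_ , s∈ , leaky)))

lemma10p2 : ∀ {n} (P : System n) → MaxMinPPS-SNF P →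
    (τ : Policy n) → IsPolicy τ →
    LDFMinPolicy P τ ⇔ (¬ ∃ λ (S : Subset n) → ClosedSet (fixMin τ P) S)
lemma10p2 P wf τ _ = mk⇔
  (λ ldf (S , closed) →
     closedSet⇒¬LDF closed (ldf _ (pointInto-isPolicy S (fixMin τ P))))
  (λ no-closed σ _ i →
     [ id , (λ closed → ⊥-elim (no-closed closed)) ] (leakOrClosedSet P wf τ σ i))
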